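{- Let $n=p_1^{\alpha_1}p_2^{\alpha_2}\cdots p_k^{\alpha_k}$ be the prime power factorization of a composite integer $n$ (distinct primes $p_i$), with $\alpha_1\ge\alpha_2\ge\cdots\ge\alpha_k$ and $\alpha_1\ge3$ if $k=1$. Let $V_2(n)$ be the set of vertices of degree two in $\Upsilon_n$. Then: (i) $V_2(p_1^3)=\emptyset$; $V_2(p_1^4)=\{p_1^3\}$; $V_2(n)=\{p_1^2,p_1^3\}$ if $n\in\{p_1^5,p_1^6\}$; (ii) $V_2(p_1p_2)=\emptyset$; $V_2(p_1^2p_2)=\{p_1^2,p_1p_2\}$; $V_2(p_1^2p_2^2)=\{p_1^2,p_2^2,p_1p_2\}$; (iii) if $n\notin\{p_1^3,p_1^4,p_1^5,p_1^6,p_1p_2,p_1^2p_2,p_1^2p_2^2\}$, then $V_2(n)=\{p_i^2:1\le i\le k,\ \alpha_i\ge2\}$.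
   Context: For an integer $n>1$, a proper divisor of $n$ is an integer $d$ with $1<d<n$ and $d\mid n$. The proper divisor graph $\Upsilon_n$ is the simple graph whose vertices are the proper divisors of $n$, two distinct vertices $u,v$ being adjacent iff $n\mid uv$. -}

module Defs where

open import Data.Nat using (ℕ; suc; _*_; _^_; _<_; _<?_)
open import Data.Nat.Properties using (_≟_)
open import Data.Nat.Divisibility using (_∣_; _∣?_)
open import Data.Nat.Primality using (Prime)
open import Data.List using (List; filter; length; upTo)
open import Data.Product using (_×_; ∃-syntax)
open import Data.Sum using (_⊎_)
open import Relation.Binary.PropositionalEquality using (_≡_; _≢_)
open import Relation.Nullary using (Dec; ¬?)
open import Relation.Nullary.Decidable using (_×-dec_)

-- d is a proper divisor of n : 1 < d < n and d ∣ n  (vertices of Υ_n)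
ProperDivisor : ℕ → ℕ → Set
ProperDivisor n d = 1 < d × d < n × d ∣ n

properDivisor? : (n d : ℕ) → Dec (ProperDivisor n d)
properDivisor? n d = (1 <? d) ×-dec ((d <? n) ×-dec (d ∣? n))

properDivisors : ℕ → List ℕ
properDivisors n = filter (properDivisor? n) (upTo n)

-- adjacency in Υ_n : distinct u, v with n ∣ u v
Adjacent : ℕ → ℕ → ℕ → Set
Adjacent n u v = u ≢ v × n ∣ u * v

adjacent? : (n u v : ℕ) → Dec (Adjacent n u v)
adjacent? n u v = ¬? (u ≟ v) ×-dec (n ∣? (u * v))

degree : ℕ → ℕ → ℕ
degree n d = length (filter (adjacent? n d) (properDivisors n))

V₂ : ℕ → ℕ → Set
V₂ n d = ProperDivisor n d × degree n d ≡ 2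

Exceptional : ℕ → Set
Exceptional n =
  (∃[ p ] (Prime p × (n ≡ p ^ 3 ⊎ n ≡ p ^ 4 ⊎ n ≡ p ^ 5 ⊎ n ≡ p ^ 6)))
  ⊎ (∃[ p ] ∃[ q ] (Prime p × Prime q × p ≢ q
       × (n ≡ p * q ⊎ n ≡ p ^ 2 * q ⊎ n ≡ p ^ 2 * q ^ 2)))

-- Write n = m * d for a proper divisor d of n.  A vertex v is adjacent to d
-- exactly when v = m * w for a divisor w < d of d with m * w ≢ d, and a w with
-- m * w ≡ d exists exactly when n ∣ d².  Hence, writing τ′(d) for the number of
-- divisors of d below d (the length of divisorsBelow d), deg d = τ′(d) if n ∤ d²
-- and deg d = τ′(d) − 1 if n ∣ d².  As τ′(d) ≤ 3 forces d = pᵏ (with τ′ = k) or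
-- d = pq (with τ′ = 3), the vertices of degree two are the p² with n ∤ p⁴ and
-- the p³ and pq with n ∣ d²; each case of the proposition amounts to deciding
-- these divisibilities.

module Submission where

open import Defs
open import Data.Nat
  using (ℕ; zero; suc; _*_; _^_; _∸_; _≤_; _<_; z≤n; s≤s; z<s; NonZero; >-nonZero; >-nonZero⁻¹; ≢-nonZero⁻¹; nonTrivial⇒n>1)
open import Data.Nat.Properties
open import Data.Nat.Divisibility
open import Data.Nat.Primality using (Prime; Composite; euclidsLemma; prime⇒irreducible; prime⇒nonZero; composite⇒nonZero; prime⇒nonTrivial; productOfPrimes≥1)
open import Data.Nat.Primality.Factorisation using (factorise)
open import Data.Nat.ListAction using (product)
open import Data.Nat.Tactic.RingSolver using (solve-∀)
open import Data.List using (List; []; _∷_; filter; length; map; upTo)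
open import Data.List.Membership.Propositional using (_∈_)
open import Data.List.Membership.Propositional.Properties
  using (∈-filter⁺; ∈-filter⁻; ∈-map⁺; ∈-map⁻; ∈-map∘filter⁺; ∈-map∘filter⁻; ∈-upTo⁺; ∈-upTo⁻)
open import Data.List.Membership.Propositional.Properties.WithK using (unique∧set⇒bag)
open import Data.List.Properties using (length-filter; filter-all; length-map; length-upTo)
open import Data.List.Relation.Binary.BagAndSetEquality using (∼bag⇒↭)
open import Data.List.Relation.Binary.Permutation.Propositional.Properties using (↭-length)
open import Data.List.Relation.Unary.All as All using (All; []; _∷_)
open import Data.List.Relation.Unary.Any using (here; there)
open import Data.List.Relation.Unary.AllPairs using ([]; _∷_)
open import Data.List.Relation.Unary.Unique.Propositional using (Unique)
import Data.List.Relation.Unary.Unique.Propositional.Properties as Unique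
open import Data.Product using (_×_; _,_; proj₁; proj₂; ∃-syntax)
open import Data.Sum using (_⊎_; inj₁; inj₂)
open import Function using (_∘_)
open import Function.Bundles using (_⇔_; mk⇔; Equivalence)
open import Relation.Binary.Definitions using (DecidableEquality)
open import Relation.Binary.PropositionalEquality
open import Relation.Nullary using (¬_; yes; no; contradiction)
open import Relation.Unary using (Decidable)
open import Relation.Unary.Properties using (∁?)

-- Counting duplicate-free lists

module _ {A : Set} where

  Unique-length-cong : ∀ {xs ys : List A} → Unique xs → Unique ys →
                       (∀ {x} → x ∈ xs ⇔ x ∈ ys) → length xs ≡ length ys
  Unique-length-cong !xs !ys xs≈ys = ↭-length (∼bag⇒↭ (unique∧set⇒bag !xs !ys xs≈ys))

  Unique-length-mono : DecidableEquality A → ∀ {xs ys : List A} → Unique xs → Unique ys →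
                       (∀ {x} → x ∈ xs → x ∈ ys) → length xs ≤ length ys
  Unique-length-mono _≟_ {xs} {ys} !xs !ys xs⊆ys = ≤-trans
    (≤-reflexive (Unique-length-cong !xs (Unique.filter⁺ {P = _∈ xs} (_∈? xs) !ys)
      (mk⇔ (λ x∈xs → ∈-filter⁺ (_∈? xs) (xs⊆ys x∈xs) x∈xs)
           (λ x∈ → proj₂ (∈-filter⁻ (_∈? xs) {xs = ys} x∈)))))
    (length-filter (_∈? xs) ys)
    where open import Data.List.Membership.DecPropositional _≟_ using (_∈?_)

  Unique-length-filter-∁ : ∀ {P : A → Set} (P? : Decidable P) {x xs} → Unique xs → x ∈ xs → P x →
                           (∀ {y} → P y → y ≡ x) → length xs ≡ suc (length (filter (∁? P?) xs))
  Unique-length-filter-∁ {P} P? {x} {xs} !xs x∈xs px P⇒≡x =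
    Unique-length-cong !xs (All.tabulate x≢ ∷ Unique.filter⁺ (∁? P?) !xs) (mk⇔ to from)
    where
    x≢ : ∀ {y} → y ∈ filter (∁? P?) xs → x ≢ y
    x≢ y∈ refl = proj₂ (∈-filter⁻ (∁? P?) {xs = xs} y∈) px
    to : ∀ {y} → y ∈ xs → y ∈ x ∷ filter (∁? P?) xs
    to {y} y∈xs with P? y
    ... | yes py = here (P⇒≡x py)
    ... | no ¬py = there (∈-filter⁺ (∁? P?) y∈xs ¬py)
    from : ∀ {y} → y ∈ x ∷ filter (∁? P?) xs → y ∈ xs
    from (here refl) = x∈xs
    from (there y∈) = proj₁ (∈-filter⁻ (∁? P?) {xs = xs} y∈)

-- Primes and prime powers

prime>1 : ∀ {p} → Prime p → 1 < p
prime>1 {p} pp = nonTrivial⇒n>1 p {{prime⇒nonTrivial pp}}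

divisor-nonZero : ∀ {n w} .{{_ : NonZero n}} → w ∣ n → NonZero w
divisor-nonZero {n} {zero} 0∣n = contradiction (0∣⇒≡0 0∣n) (≢-nonZero⁻¹ n)
divisor-nonZero {w = suc _} _ = _

nontrivial-divisor : ∀ {n w} .{{_ : NonZero n}} → w ∣ n → w ≢ 1 → 1 < w
nontrivial-divisor {w = w} w∣n w≢1 = ≤∧≢⇒< (>-nonZero⁻¹ w {{divisor-nonZero w∣n}}) (w≢1 ∘ sym)

primeDivisor : ∀ {n} → 1 < n → ∃[ p ] Prime p × p ∣ n
primeDivisor {n} 1<n with factorise n {{>-nonZero (<-trans z<s 1<n)}}
... | record { factors = [] ; isFactorisation = n≡1 } = contradiction (sym n≡1) (<⇒≢ 1<n)
... | record { factors = p ∷ ps ; isFactorisation = n≡p*ps ; factorsPrime = pp ∷ _ } =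
  p , pp , divides (product ps) (trans n≡p*ps (*-comm p (product ps)))

prime∣prime⇒≡ : ∀ {p q} → Prime p → Prime q → p ∣ q → p ≡ q
prime∣prime⇒≡ pp pq p∣q with prime⇒irreducible pq p∣q
... | inj₁ p≡1 = contradiction (sym p≡1) (<⇒≢ (prime>1 pp))
... | inj₂ p≡q = p≡q

prime∣^⇒≡ : ∀ {p q} → Prime p → Prime q → ∀ k → p ∣ q ^ k → p ≡ q
prime∣^⇒≡ pp pq zero p∣1 = contradiction (sym (∣1⇒≡1 p∣1)) (<⇒≢ (prime>1 pp))
prime∣^⇒≡ {q = q} pp pq (suc k) p∣q^k+1 with euclidsLemma q (q ^ k) pp p∣q^k+1
... | inj₁ p∣q = prime∣prime⇒≡ pp pq p∣q
... | inj₂ p∣q^k = prime∣^⇒≡ pp pq k p∣q^k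

∣-prime^ : ∀ {p} → Prime p → ∀ k {w} → w ∣ p ^ k → ∃[ j ] j ≤ k × w ≡ p ^ j
∣-prime^ pp zero w∣1 = 0 , z≤n , ∣1⇒≡1 w∣1
∣-prime^ {p} pp (suc k) {w} w∣p^k+1 with w ≟ 1
... | yes w≡1 = 0 , z≤n , w≡1
... | no w≢1 with primeDivisor (nontrivial-divisor {{m^n≢0 p (suc k) {{prime⇒nonZero pp}}}} w∣p^k+1 w≢1)
... | r , pr , divides w′ refl with prime∣^⇒≡ pr pp (suc k) (∣-trans (n∣m*n w′) w∣p^k+1)
... | refl with ∣-prime^ pp k {w′} (*-cancelʳ-∣ p {{prime⇒nonZero pp}} (subst (w′ * p ∣_) (*-comm p (p ^ k)) w∣p^k+1))
... | j , j≤k , refl = suc j , s≤s j≤k , *-comm (p ^ j) p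

∣-*-primes : ∀ {p q w} → Prime p → Prime q → w ∣ p * q → w ≡ 1 ⊎ w ≡ p ⊎ w ≡ q ⊎ w ≡ p * q
∣-*-primes {p} {q} {w} pp pq w∣pq with w ≟ 1
... | yes w≡1 = inj₁ w≡1
... | no w≢1 with primeDivisor (nontrivial-divisor {{m*n≢0 p q {{prime⇒nonZero pp}} {{prime⇒nonZero pq}}}} w∣pq w≢1)
... | r , pr , divides w′ refl with euclidsLemma p q pr (∣-trans (n∣m*n w′) w∣pq)
... | inj₁ r∣p with prime∣prime⇒≡ pr pp r∣p
...   | refl with prime⇒irreducible pq {w′} (*-cancelˡ-∣ r {{prime⇒nonZero pp}} (subst (_∣ r * q) (*-comm w′ r) w∣pq))
...     | inj₁ refl = inj₂ (inj₁ (*-identityˡ r))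
...     | inj₂ refl = inj₂ (inj₂ (inj₂ (*-comm w′ r)))
∣-*-primes {p} {q} pp pq w∣pq | no _ | r , pr , divides w′ refl | inj₂ r∣q with prime∣prime⇒≡ pr pq r∣q
...   | refl with prime⇒irreducible pp {w′} (*-cancelʳ-∣ r {{prime⇒nonZero pq}} w∣pq)
...     | inj₁ refl = inj₂ (inj₂ (inj₁ (*-identityˡ r)))
...     | inj₂ refl = inj₂ (inj₂ (inj₂ refl))

^-monoʳ-∣ : ∀ p {i j} → i ≤ j → p ^ i ∣ p ^ j
^-monoʳ-∣ p {i} {j} i≤j = divides (p ^ (j ∸ i)) (trans (cong (p ^_) (sym (m∸n+n≡m i≤j))) (^-distribˡ-+-* p (j ∸ i) i))

module _ {p : ℕ} (1<p : 1 < p) where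

  private instance
    p≢0 : NonZero p
    p≢0 = >-nonZero (<-trans z<s 1<p)

  ^-cancelʳ-∣ : ∀ {i j} → p ^ i ∣ p ^ j → i ≤ j
  ^-cancelʳ-∣ {i} {j} p^i∣p^j = ≮⇒≥ (λ j<i → <⇒≱ (^-monoʳ-< p 1<p j<i) (∣⇒≤ {{m^n≢0 p j}} p^i∣p^j))

  ^-cancelʳ-< : ∀ {i j} → p ^ i < p ^ j → i < j
  ^-cancelʳ-< p^i<p^j = ≰⇒> (λ j≤i → <⇒≱ p^i<p^j (^-monoʳ-≤ p j≤i))

  ^-injective : ∀ {i j} → p ^ i ≡ p ^ j → i ≡ j
  ^-injective e = ≤-antisym (^-cancelʳ-∣ (∣-reflexive e)) (^-cancelʳ-∣ (∣-reflexive (sym e)))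

-- Divisors below d

divisorsBelow : ℕ → List ℕ
divisorsBelow d = filter (_∣? d) (upTo d)

∈-divisorsBelow : ∀ {d w} → w ∈ divisorsBelow d ⇔ (w ∣ d × w < d)
∈-divisorsBelow {d} = mk⇔
  (λ w∈ → let (w∈upTo , w∣d) = ∈-filter⁻ (_∣? d) {xs = upTo d} w∈ in w∣d , ∈-upTo⁻ w∈upTo)
  (λ (w∣d , w<d) → ∈-filter⁺ (_∣? d) (∈-upTo⁺ w<d) w∣d)

divisorsBelow-unique : ∀ d → Unique (divisorsBelow d)
divisorsBelow-unique d = Unique.filter⁺ (_∣? d) (Unique.upTo⁺ d)

length-divisorsBelow : ∀ {d xs} → Unique xs → (∀ {w} → w ∈ xs ⇔ (w ∣ d × w < d)) →
                       length (divisorsBelow d) ≡ length xs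
length-divisorsBelow {d} !xs xs≈ = Unique-length-cong (divisorsBelow-unique d) !xs
  (mk⇔ (Equivalence.from xs≈ ∘ Equivalence.to ∈-divisorsBelow)
       (Equivalence.from ∈-divisorsBelow ∘ Equivalence.to xs≈))

length-divisorsBelow-≥ : ∀ {d xs} → Unique xs → All (λ w → w ∣ d × w < d) xs →
                         length xs ≤ length (divisorsBelow d)
length-divisorsBelow-≥ {d} !xs below = Unique-length-mono _≟_ !xs (divisorsBelow-unique d)
  (Equivalence.from ∈-divisorsBelow ∘ All.lookup below)

length-divisorsBelow-^ : ∀ {p} → Prime p → ∀ k → length (divisorsBelow (p ^ k)) ≡ k
length-divisorsBelow-^ {p} pp k = begin
  length (divisorsBelow (p ^ k))  ≡⟨ length-divisorsBelow (Unique.map⁺ (^-injective 1<p) (Unique.upTo⁺ k)) (mk⇔ to from) ⟩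
  length (map (p ^_) (upTo k))    ≡⟨ length-map (p ^_) (upTo k) ⟩
  length (upTo k)                 ≡⟨ length-upTo k ⟩
  k                               ∎
  where
  open ≡-Reasoning
  1<p = prime>1 pp
  to : ∀ {w} → w ∈ map (p ^_) (upTo k) → w ∣ p ^ k × w < p ^ k
  to w∈ with ∈-map⁻ (p ^_) w∈
  ... | j , j∈ , refl = ^-monoʳ-∣ p (<⇒≤ (∈-upTo⁻ j∈)) , ^-monoʳ-< p 1<p (∈-upTo⁻ j∈)
  from : ∀ {w} → w ∣ p ^ k × w < p ^ k → w ∈ map (p ^_) (upTo k)
  from (w∣p^k , w<p^k) with ∣-prime^ pp k w∣p^k
  ... | j , _ , refl = ∈-map⁺ (p ^_) (∈-upTo⁺ {k} {j} (^-cancelʳ-< 1<p w<p^k))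

length-divisorsBelow-* : ∀ {p q} → Prime p → Prime q → p ≢ q → length (divisorsBelow (p * q)) ≡ 3
length-divisorsBelow-* {p} {q} pp pq p≢q = length-divisorsBelow
  ((<⇒≢ 1<p ∷ <⇒≢ 1<q ∷ []) ∷ (p≢q ∷ []) ∷ [] ∷ []) (mk⇔ to from)
  where
  1<p = prime>1 pp
  1<q = prime>1 pq
  instance
    p≢0 = prime⇒nonZero pp
    q≢0 = prime⇒nonZero pq
  to : ∀ {w} → w ∈ 1 ∷ p ∷ q ∷ [] → w ∣ p * q × w < p * q
  to (here refl) = 1∣ (p * q) , <-≤-trans 1<p (m≤m*n p q)
  to (there (here refl)) = m∣m*n q , m<m*n p q 1<q
  to (there (there (here refl))) = n∣m*n p , subst (q <_) (*-comm q p) (m<m*n q p 1<p)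
  from : ∀ {w} → w ∣ p * q × w < p * q → w ∈ 1 ∷ p ∷ q ∷ []
  from (w∣pq , w<pq) with ∣-*-primes pp pq w∣pq
  ... | inj₁ refl = here refl
  ... | inj₂ (inj₁ refl) = there (here refl)
  ... | inj₂ (inj₂ (inj₁ refl)) = there (there (here refl))
  ... | inj₂ (inj₂ (inj₂ refl)) = contradiction w<pq (<-irrefl refl)

4≤length-divisorsBelow-* : ∀ {p q d} → Prime p → Prime q → p ≢ q → p * q ∣ d → p * q < d →
                           4 ≤ length (divisorsBelow d)
4≤length-divisorsBelow-* {p} {q} {d} pp pq p≢q pq∣d pq<d = length-divisorsBelow-≥
  ((<⇒≢ 1<p ∷ <⇒≢ 1<q ∷ <⇒≢ (<-trans 1<p p<pq) ∷ []) ∷ (p≢q ∷ <⇒≢ p<pq ∷ []) ∷ (<⇒≢ q<pq ∷ []) ∷ [] ∷ [])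
  ( (1∣ d , <-trans 1<p (<-trans p<pq pq<d))
  ∷ (∣-trans (m∣m*n q) pq∣d , <-trans p<pq pq<d)
  ∷ (∣-trans (n∣m*n p) pq∣d , <-trans q<pq pq<d)
  ∷ (pq∣d , pq<d)
  ∷ [])
  where
  1<p = prime>1 pp
  1<q = prime>1 pq
  instance
    p≢0 = prime⇒nonZero pp
    q≢0 = prime⇒nonZero pq
  p<pq : p < p * q
  p<pq = m<m*n p q 1<q
  q<pq : q < p * q
  q<pq = subst (q <_) (*-comm q p) (m<m*n q p 1<p)

4≤length-divisorsBelow-*-*-* : ∀ {a b c e} → 1 < a → 1 < b → 1 < c → 1 < e →
                               4 ≤ length (divisorsBelow (a * (b * (c * e))))
4≤length-divisorsBelow-*-*-* {a} {b} {c} {e} 1<a 1<b 1<c 1<e = length-divisorsBelow-≥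
  ( (<⇒≢ 1<a ∷ <⇒≢ (<-trans 1<a a<ab) ∷ <⇒≢ (<-trans 1<a (<-trans a<ab ab<abc)) ∷ [])
  ∷ (<⇒≢ a<ab ∷ <⇒≢ (<-trans a<ab ab<abc) ∷ [])
  ∷ (<⇒≢ ab<abc ∷ [])
  ∷ [] ∷ [])
  ( (1∣ _ , <-trans 1<a (<-trans a<ab (<-trans ab<abc abc<d)))
  ∷ (m∣m*n (b * (c * e)) , <-trans a<ab (<-trans ab<abc abc<d))
  ∷ (*-monoʳ-∣ a (m∣m*n (c * e)) , <-trans ab<abc abc<d)
  ∷ (*-monoʳ-∣ a (*-monoʳ-∣ b (m∣m*n e)) , abc<d)
  ∷ [])
  where
  instance
    a≢0 = >-nonZero (<-trans z<s 1<a)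
    b≢0 = >-nonZero (<-trans z<s 1<b)
    c≢0 = >-nonZero (<-trans z<s 1<c)
  a<ab : a < a * b
  a<ab = m<m*n a b 1<b
  ab<abc : a * b < a * (b * c)
  ab<abc = *-monoʳ-< a (m<m*n b c 1<c)
  abc<d : a * (b * c) < a * (b * (c * e))
  abc<d = *-monoʳ-< a (*-monoʳ-< b (m<m*n c e 1<e))

length-divisorsBelow≤3⇒prime^⊎semiprime : ∀ {d} → 1 < d → length (divisorsBelow d) ≤ 3 →
               (∃[ p ] ∃[ k ] Prime p × d ≡ p ^ k) ⊎ (∃[ p ] ∃[ q ] Prime p × Prime q × p ≢ q × d ≡ p * q)
length-divisorsBelow≤3⇒prime^⊎semiprime {d} 1<d τ≤3 with factorise d {{>-nonZero (<-trans z<s 1<d)}}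
... | record { factors = [] ; isFactorisation = refl } = contradiction 1<d (<-irrefl refl)
... | record { factors = p ∷ [] ; isFactorisation = refl ; factorsPrime = pp ∷ [] } = inj₁ (p , 1 , pp , refl)
... | record { factors = p ∷ r ∷ [] ; isFactorisation = refl ; factorsPrime = pp ∷ pr ∷ [] } with p ≟ r
...   | yes refl = inj₁ (p , 2 , pp , refl)
...   | no p≢r = inj₂ (p , r , pp , pr , p≢r , cong (p *_) (*-identityʳ r))
length-divisorsBelow≤3⇒prime^⊎semiprime {d} 1<d τ≤3
    | record { factors = p ∷ r ∷ f ∷ [] ; isFactorisation = refl ; factorsPrime = pp ∷ pr ∷ pf ∷ [] }
    with p ≟ r | p ≟ f
... | no p≢r | _ = contradiction
  (4≤length-divisorsBelow-* pp pr p≢r (*-monoʳ-∣ p (m∣m*n (f * 1))) (*-monoʳ-< p {{prime⇒nonZero pp}} r<r*f))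
  (<⇒≱ (s≤s τ≤3))
  where r<r*f = m<m*n r (f * 1) {{prime⇒nonZero pr}} (subst (1 <_) (sym (*-identityʳ f)) (prime>1 pf))
... | yes refl | no p≢f = contradiction
  (4≤length-divisorsBelow-* pp pf p≢f (*-monoʳ-∣ p (∣-trans (m∣m*n 1) (n∣m*n p))) (*-monoʳ-< p {{prime⇒nonZero pp}} f<p*f))
  (<⇒≱ (s≤s τ≤3))
  where f<p*f = subst₂ _<_ (*-identityʳ f) (*-comm (f * 1) p) (m<m*n (f * 1) p {{m*n≢0 f 1 {{prime⇒nonZero pf}}}} (prime>1 pp))
... | yes refl | yes refl = inj₁ (p , 3 , pp , refl)
length-divisorsBelow≤3⇒prime^⊎semiprime {d} 1<d τ≤3
    | record { factors = p ∷ r ∷ f ∷ g ∷ gs ; isFactorisation = refl ; factorsPrime = pp ∷ pr ∷ pf ∷ pg ∷ pgs } =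
  contradiction
  (4≤length-divisorsBelow-*-*-* (prime>1 pp) (prime>1 pr) (prime>1 pf)
    (<-≤-trans (prime>1 pg) (m≤m*n g (product gs) {{>-nonZero (productOfPrimes≥1 pgs)}})))
  (<⇒≱ (s≤s τ≤3))

-- Degrees in Υ_n

neighbours : ℕ → ℕ → List ℕ
neighbours n d = filter (adjacent? n d) (properDivisors n)

∈-neighbours : ∀ {n d v} → v ∈ neighbours n d ⇔ (ProperDivisor n v × Adjacent n d v)
∈-neighbours {n} {d} = mk⇔
  (λ v∈ → let (v∈pd , adj) = ∈-filter⁻ (adjacent? n d) {xs = properDivisors n} v∈
          in proj₂ (∈-filter⁻ (properDivisor? n) {xs = upTo n} v∈pd) , adj)
  (λ (pd@(_ , v<n , _) , adj) → ∈-filter⁺ (adjacent? n d) (∈-filter⁺ (properDivisor? n) (∈-upTo⁺ v<n) pd) adj)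

neighbours-unique : ∀ n d → Unique (neighbours n d)
neighbours-unique n d = Unique.filter⁺ (adjacent? n d) (Unique.filter⁺ (properDivisor? n) (Unique.upTo⁺ n))

module Cofactor {n d m : ℕ} (1<d : 1 < d) (d<n : d < n) (n≡m*d : n ≡ m * d) where

  1<m : 1 < m
  1<m = *-cancelʳ-< d 1 m (subst₂ _<_ (sym (*-identityˡ d)) n≡m*d d<n)

  instance
    m≢0 : NonZero m
    m≢0 = >-nonZero (<-trans z<s 1<m)
    d≢0 : NonZero d
    d≢0 = >-nonZero (<-trans z<s 1<d)

  covers? : Decidable (λ w → m * w ≡ d)
  covers? w = m * w ≟ d

  n∣d*[m*w] : ∀ w → n ∣ d * (m * w)
  n∣d*[m*w] w = subst (_∣ d * (m * w)) (sym n≡m*d) (divides w (d*[m*w]≡w*[m*d] d m w))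
    where d*[m*w]≡w*[m*d] : ∀ d m w → d * (m * w) ≡ w * (m * d)
          d*[m*w]≡w*[m*d] = solve-∀

  covers⇒square : ∀ {w} → m * w ≡ d → n ∣ d * d
  covers⇒square {w} mw≡d = subst (λ x → n ∣ d * x) mw≡d (n∣d*[m*w] w)

  square⇒covers : n ∣ d * d → ∃[ w ] w ∈ divisorsBelow d × m * w ≡ d
  square⇒covers n∣dd = w , Equivalence.from ∈-divisorsBelow (w∣d , w<d) , sym d≡mw
    where
    m∣d : m ∣ d
    m∣d = *-cancelʳ-∣ d (subst (_∣ d * d) n≡m*d n∣dd)
    w = quotient m∣d
    d≡mw : d ≡ m * w
    d≡mw = m∣n⇒n≡m*quotient m∣d
    w∣d : w ∣ d
    w∣d = quotient-∣ m∣d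
    w<d : w < d
    w<d = subst (w <_) (trans (*-comm w m) (sym d≡mw)) (m<m*n w m {{divisor-nonZero {d} w∣d}} 1<m)

  neighbour⇔ : ∀ {v} → (ProperDivisor n v × Adjacent n d v) ⇔
               (∃[ w ] w ∈ divisorsBelow d × v ≡ m * w × ¬ m * w ≡ d)
  neighbour⇔ {v} = mk⇔ to from
    where
    to : ProperDivisor n v × Adjacent n d v → ∃[ w ] w ∈ divisorsBelow d × v ≡ m * w × ¬ m * w ≡ d
    to ((_ , v<n , v∣n) , d≢v , n∣dv) = w , Equivalence.from ∈-divisorsBelow (w∣d , w<d) , v≡mw , d≢v ∘ sym ∘ trans v≡mw
      where
      m∣v : m ∣ v
      m∣v = *-cancelˡ-∣ d (subst (_∣ d * v) (trans n≡m*d (*-comm m d)) n∣dv)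
      w = quotient m∣v
      v≡mw : v ≡ m * w
      v≡mw = m∣n⇒n≡m*quotient m∣v
      w∣d : w ∣ d
      w∣d = *-cancelˡ-∣ m (subst₂ _∣_ v≡mw n≡m*d v∣n)
      w<d : w < d
      w<d = *-cancelˡ-< m w d (subst₂ _<_ v≡mw n≡m*d v<n)
    from : ∃[ w ] w ∈ divisorsBelow d × v ≡ m * w × ¬ m * w ≡ d → ProperDivisor n v × Adjacent n d v
    from (w , w∈ , refl , mw≢d) = (1<mw , mw<n , mw∣n) , mw≢d ∘ sym , n∣d*[m*w] w
      where
      w∣d = proj₁ (Equivalence.to ∈-divisorsBelow w∈)
      w<d = proj₂ (Equivalence.to ∈-divisorsBelow w∈)
      1<mw : 1 < m * w
      1<mw = <-≤-trans 1<m (m≤m*n m w {{divisor-nonZero {d} w∣d}})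
      mw<n : m * w < n
      mw<n = subst (m * w <_) (sym n≡m*d) (*-monoʳ-< m w<d)
      mw∣n : m * w ∣ n
      mw∣n = subst (m * w ∣_) (sym n≡m*d) (*-monoʳ-∣ m w∣d)

  degree≡ : degree n d ≡ length (filter (∁? covers?) (divisorsBelow d))
  degree≡ = trans
    (Unique-length-cong (neighbours-unique n d)
      (Unique.map⁺ (*-cancelˡ-≡ _ _ m) (Unique.filter⁺ (∁? covers?) (divisorsBelow-unique d)))
      (mk⇔ (∈-map∘filter⁺ (m *_) (∁? covers?) ∘ Equivalence.to neighbour⇔ ∘ Equivalence.to ∈-neighbours)
           (Equivalence.from ∈-neighbours ∘ Equivalence.from neighbour⇔ ∘ ∈-map∘filter⁻ (m *_) (∁? covers?))))
    (length-map (m *_) (filter (∁? covers?) (divisorsBelow d)))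

degree-nonsquare : ∀ {n d} → ProperDivisor n d → ¬ n ∣ d * d → degree n d ≡ length (divisorsBelow d)
degree-nonsquare {d = d} (1<d , d<n , divides m n≡m*d) ¬sq = trans degree≡
  (cong length (filter-all (∁? covers?) (All.universal (λ _ → ¬sq ∘ covers⇒square) (divisorsBelow d))))
  where open Cofactor {m = m} 1<d d<n n≡m*d

degree-square : ∀ {n d} → ProperDivisor n d → n ∣ d * d → suc (degree n d) ≡ length (divisorsBelow d)
degree-square {d = d} (1<d , d<n , divides m n≡m*d) sq =
  let w₀ , w₀∈ , mw₀≡d = square⇒covers sq in
  trans (cong suc degree≡) (sym (Unique-length-filter-∁ covers? (divisorsBelow-unique d) w₀∈ mw₀≡d
    (λ mw≡d → *-cancelˡ-≡ _ _ m (trans mw≡d (sym mw₀≡d)))))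
  where open Cofactor {m = m} 1<d d<n n≡m*d

-- Vertices of degree two

data V₂Shape (n : ℕ) : ℕ → Set where
  square    : ∀ {p} → Prime p → ¬ n ∣ p ^ 2 * p ^ 2 → V₂Shape n (p ^ 2)
  cube      : ∀ {p} → Prime p → n ∣ p ^ 3 * p ^ 3 → V₂Shape n (p ^ 3)
  semiprime : ∀ {p q} → Prime p → Prime q → p ≢ q → n ∣ (p * q) * (p * q) → V₂Shape n (p * q)

V₂⇔ : ∀ {n d} → V₂ n d ⇔ (ProperDivisor n d × V₂Shape n d)
V₂⇔ {n} {d} = mk⇔ to from
  where
  to : V₂ n d → ProperDivisor n d × V₂Shape n d
  to (pd@(1<d , _ , _) , deg≡2) with n ∣? d * d
  ... | no ¬sq = pd , shape (trans (sym (degree-nonsquare pd ¬sq)) deg≡2)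
    where
    shape : length (divisorsBelow d) ≡ 2 → V₂Shape n d
    shape τ≡2 with length-divisorsBelow≤3⇒prime^⊎semiprime 1<d (≤-trans (≤-reflexive τ≡2) (n≤1+n 2))
    ... | inj₁ (p , k , pp , refl) with trans (sym (length-divisorsBelow-^ pp k)) τ≡2
    ...   | refl = square pp ¬sq
    shape τ≡2 | inj₂ (p , q , pp , pq , p≢q , refl) = contradiction (trans (sym τ≡2) (length-divisorsBelow-* pp pq p≢q)) λ ()
  ... | yes sq = pd , shape (trans (sym (degree-square pd sq)) (cong suc deg≡2))
    where
    shape : length (divisorsBelow d) ≡ 3 → V₂Shape n d
    shape τ≡3 with length-divisorsBelow≤3⇒prime^⊎semiprime 1<d (≤-reflexive τ≡3)
    ... | inj₁ (p , k , pp , refl) with trans (sym (length-divisorsBelow-^ pp k)) τ≡3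
    ...   | refl = cube pp sq
    shape τ≡3 | inj₂ (p , q , pp , pq , p≢q , refl) = semiprime pp pq p≢q sq
  from : ProperDivisor n d × V₂Shape n d → V₂ n d
  from (pd , square pp ¬sq) = pd , trans (degree-nonsquare pd ¬sq) (length-divisorsBelow-^ pp 2)
  from (pd , cube pp sq) = pd , suc-injective (trans (degree-square pd sq) (length-divisorsBelow-^ pp 3))
  from (pd , semiprime pp pq p≢q sq) = pd , suc-injective (trans (degree-square pd sq) (length-divisorsBelow-* pp pq p≢q))

properDivisor-^ : ∀ {p i k} → 1 < p → 0 < i → i < k → ProperDivisor (p ^ k) (p ^ i)
properDivisor-^ {p} 1<p 0<i i<k = ^-monoʳ-< p 1<p 0<i , ^-monoʳ-< p 1<p i<k , ^-monoʳ-∣ p (<⇒≤ i<k)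

V₂-p^k : ∀ {p} → Prime p → ∀ k d → V₂ (p ^ k) d ⇔ (d ≡ p ^ 2 × 4 < k ⊎ d ≡ p ^ 3 × 3 < k × k ≤ 6)
V₂-p^k {p} pp k d = mk⇔ to from
  where
  1<p = prime>1 pp
  to : V₂ (p ^ k) d → d ≡ p ^ 2 × 4 < k ⊎ d ≡ p ^ 3 × 3 < k × k ≤ 6
  to v with Equivalence.to V₂⇔ v
  ... | (_ , _ , d∣n) , square {r} pr ¬sq with prime∣^⇒≡ pr pp k (∣-trans (m∣m*n (r * 1)) d∣n)
  ...   | refl = inj₁ (refl , ≰⇒> (¬sq ∘ subst (p ^ k ∣_) (^-distribˡ-+-* p 2 2) ∘ ^-monoʳ-∣ p))
  to v | (_ , d<n , d∣n) , cube {r} pr sq with prime∣^⇒≡ pr pp k (∣-trans (m∣m*n (r ^ 2)) d∣n)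
  ...   | refl = inj₂ (refl , ^-cancelʳ-< 1<p d<n , ^-cancelʳ-∣ 1<p (subst (p ^ k ∣_) (sym (^-distribˡ-+-* p 3 3)) sq))
  to v | (_ , _ , d∣n) , semiprime {r} {s} pr ps r≢s _ = contradiction
    (trans (prime∣^⇒≡ pr pp k (∣-trans (m∣m*n s) d∣n)) (sym (prime∣^⇒≡ ps pp k (∣-trans (n∣m*n r) d∣n)))) r≢s
  from : d ≡ p ^ 2 × 4 < k ⊎ d ≡ p ^ 3 × 3 < k × k ≤ 6 → V₂ (p ^ k) d
  from (inj₁ (refl , 4<k)) = Equivalence.from V₂⇔
    ( properDivisor-^ 1<p z<s (<-trans (n<1+n 2) (<-trans (n<1+n 3) 4<k))
    , square pp (<⇒≱ 4<k ∘ ^-cancelʳ-∣ 1<p ∘ subst (p ^ k ∣_) (sym (^-distribˡ-+-* p 2 2))))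
  from (inj₂ (refl , 3<k , k≤6)) = Equivalence.from V₂⇔
    (properDivisor-^ 1<p z<s 3<k , cube pp (subst (p ^ k ∣_) (^-distribˡ-+-* p 3 3) (^-monoʳ-∣ p k≤6)))

V₂-p³ : ∀ {p} → Prime p → ∀ d → ¬ V₂ (p ^ 3) d
V₂-p³ pp d v with Equivalence.to (V₂-p^k pp 3 d) v
... | inj₁ (_ , s≤s (s≤s (s≤s ())))
... | inj₂ (_ , 3<3 , _) = <-irrefl refl 3<3

V₂-p⁴ : ∀ {p} → Prime p → ∀ d → V₂ (p ^ 4) d ⇔ d ≡ p ^ 3
V₂-p⁴ {p} pp d = mk⇔ to (λ d≡p³ → Equivalence.from (V₂-p^k pp 4 d) (inj₂ (d≡p³ , ≤-refl , m≤m+n 4 2)))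
  where
  to : V₂ (p ^ 4) d → d ≡ p ^ 3
  to v with Equivalence.to (V₂-p^k pp 4 d) v
  ... | inj₁ (_ , 4<4) = contradiction 4<4 (<-irrefl refl)
  ... | inj₂ (d≡p³ , _) = d≡p³

V₂-p⁵⋯p⁶ : ∀ {p k} → Prime p → 5 ≤ k → k ≤ 6 → ∀ d → V₂ (p ^ k) d ⇔ (d ≡ p ^ 2 ⊎ d ≡ p ^ 3)
V₂-p⁵⋯p⁶ {p} {k} pp 5≤k k≤6 d = mk⇔ to from
  where
  to : V₂ (p ^ k) d → d ≡ p ^ 2 ⊎ d ≡ p ^ 3
  to v with Equivalence.to (V₂-p^k pp k d) v
  ... | inj₁ (d≡p² , _) = inj₁ d≡p²
  ... | inj₂ (d≡p³ , _) = inj₂ d≡p³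
  from : d ≡ p ^ 2 ⊎ d ≡ p ^ 3 → V₂ (p ^ k) d
  from (inj₁ d≡p²) = Equivalence.from (V₂-p^k pp k d) (inj₁ (d≡p² , 5≤k))
  from (inj₂ d≡p³) = Equivalence.from (V₂-p^k pp k d) (inj₂ (d≡p³ , <-trans (n<1+n 3) 5≤k , k≤6))

^-∣-*-^⇒≤ : ∀ {p m c a} → Prime p → ¬ p ∣ m → p ^ c ∣ m * p ^ a → c ≤ a
^-∣-*-^⇒≤ {p} {m} {c} {a} pp p∤m p^c∣m*p^a = ≮⇒≥ (λ a<c → p∤m (*-cancelʳ-∣ (p ^ a) {{m^n≢0 p a {{prime⇒nonZero pp}}}}
  (∣-trans (^-monoʳ-∣ p a<c) p^c∣m*p^a)))

prime∣^*^ : ∀ {p q r} a b → Prime p → Prime q → Prime r → r ∣ p ^ a * q ^ b → r ≡ p ⊎ r ≡ q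
prime∣^*^ {p} {q} a b pp pq pr r∣n with euclidsLemma (p ^ a) (q ^ b) pr r∣n
... | inj₁ r∣p^a = inj₁ (prime∣^⇒≡ pr pp a r∣p^a)
... | inj₂ r∣q^b = inj₂ (prime∣^⇒≡ pr pq b r∣q^b)

square∈V₂ : ∀ {n p q} .{{_ : NonZero n}} → Prime p → Prime q → q ≢ p → p ^ 2 ∣ n → q ∣ n → V₂ n (p ^ 2)
square∈V₂ {n} {p} {q} pp pq q≢p p²∣n q∣n = Equivalence.from V₂⇔
  ( (^-monoʳ-< p (prime>1 pp) {0} {2} z<s , ≤∧≢⇒< (∣⇒≤ p²∣n) (q∤ 2 ∘ λ p²≡n → subst (q ∣_) (sym p²≡n) q∣n) , p²∣n)
  , square pp (q∤ 4 ∘ ∣-trans q∣n ∘ subst (n ∣_) (sym (^-distribˡ-+-* p 2 2))))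
  where
  q∤ : ∀ k → ¬ q ∣ p ^ k
  q∤ k = q≢p ∘ prime∣^⇒≡ pq pp k

-- Stated with p * (p * 1) for p ^ 2, a form the ring solver rejects.
[pq]²≡p²q² : ∀ p q → (p * q) * (p * q) ≡ p * (p * 1) * (q * (q * 1))
[pq]²≡p²q² = solve-∀

p*[p*q]≡p²q : ∀ p q → p * (p * q) ≡ p * (p * 1) * q
p*[p*q]≡p²q = solve-∀

module _ {p q : ℕ} (pp : Prime p) (pq : Prime q) (p≢q : p ≢ q) where

  private
    1<p = prime>1 pp
    1<q = prime>1 pq
    instance
      p≢0 = prime⇒nonZero pp
      q≢0 = prime⇒nonZero pq

    p∤q^ : ∀ k → ¬ p ∣ q ^ k
    p∤q^ k = p≢q ∘ prime∣^⇒≡ pp pq k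
    q∤p^ : ∀ k → ¬ q ∣ p ^ k
    q∤p^ k = p≢q ∘ sym ∘ prime∣^⇒≡ pq pp k

  module _ {a b : ℕ} (1≤a : 1 ≤ a) (1≤b : 1 ≤ b) where

    private
      instance
        n≢0 = m*n≢0 (p ^ a) (q ^ b) {{m^n≢0 p a}} {{m^n≢0 q b}}

      p∣p^a : p ∣ p ^ a
      p∣p^a = ∣-trans (∣-reflexive (sym (*-identityʳ p))) (^-monoʳ-∣ p 1≤a)
      q∣q^b : q ∣ q ^ b
      q∣q^b = ∣-trans (∣-reflexive (sym (*-identityʳ q))) (^-monoʳ-∣ q 1≤b)

      semiprime-bounds : p ^ a * q ^ b ∣ (p * q) * (p * q) → p * q < p ^ a * q ^ b →
                         a ≤ 2 × b ≤ 2 × (2 ≤ a ⊎ 2 ≤ b)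
      semiprime-bounds sq pq<n = a≤2 , b≤2 , wide
        where
        n∣p²q² = subst (p ^ a * q ^ b ∣_) ([pq]²≡p²q² p q) sq
        a≤2 = ^-∣-*-^⇒≤ pp (p∤q^ 2) (subst (p ^ a ∣_) (*-comm (p ^ 2) (q ^ 2)) (∣-trans (m∣m*n (q ^ b)) n∣p²q²))
        b≤2 = ^-∣-*-^⇒≤ pq (q∤p^ 2) (∣-trans (n∣m*n (p ^ a)) n∣p²q²)
        wide : 2 ≤ a ⊎ 2 ≤ b
        wide with 2 ≤? a | 2 ≤? b
        ... | yes 2≤a | _ = inj₁ 2≤a
        ... | no _ | yes 2≤b = inj₂ 2≤b
        ... | no 2≰a | no 2≰b with ≤-antisym (≤-pred (≰⇒> 2≰a)) 1≤a | ≤-antisym (≤-pred (≰⇒> 2≰b)) 1≤b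
        ...   | refl | refl = contradiction pq<n (<-irrefl (sym (cong₂ _*_ (*-identityʳ p) (*-identityʳ q))))

      semiprime<n : 2 ≤ a ⊎ 2 ≤ b → p * q < p ^ a * q ^ b
      semiprime<n (inj₁ 2≤a) = <-≤-trans (*-monoˡ-< q (subst (_< p ^ a) (*-identityʳ p) (^-monoʳ-< p 1<p 2≤a)))
                                         (*-monoʳ-≤ (p ^ a) (subst (_≤ q ^ b) (*-identityʳ q) (^-monoʳ-≤ q 1≤b)))
      semiprime<n (inj₂ 2≤b) = <-≤-trans (*-monoʳ-< p (subst (_< q ^ b) (*-identityʳ q) (^-monoʳ-< q 1<q 2≤b)))
                                         (*-monoˡ-≤ (q ^ b) (subst (_≤ p ^ a) (*-identityʳ p) (^-monoʳ-≤ p 1≤a)))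

    V₂-p^a*q^b : ∀ d → V₂ (p ^ a * q ^ b) d ⇔
      (d ≡ p ^ 2 × 2 ≤ a ⊎ d ≡ q ^ 2 × 2 ≤ b ⊎ d ≡ p * q × a ≤ 2 × b ≤ 2 × (2 ≤ a ⊎ 2 ≤ b))
    V₂-p^a*q^b d = mk⇔ to from
      where
      to : V₂ (p ^ a * q ^ b) d →
           d ≡ p ^ 2 × 2 ≤ a ⊎ d ≡ q ^ 2 × 2 ≤ b ⊎ d ≡ p * q × a ≤ 2 × b ≤ 2 × (2 ≤ a ⊎ 2 ≤ b)
      to v with Equivalence.to V₂⇔ v
      ... | (_ , _ , d∣n) , square {r} pr _ with prime∣^*^ a b pp pq pr (∣-trans (m∣m*n (r * 1)) d∣n)
      ...   | inj₁ refl = inj₁ (refl , ^-∣-*-^⇒≤ pp (p∤q^ b) (subst (p ^ 2 ∣_) (*-comm (p ^ a) (q ^ b)) d∣n))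
      ...   | inj₂ refl = inj₂ (inj₁ (refl , ^-∣-*-^⇒≤ pq (q∤p^ a) d∣n))
      to v | (_ , _ , d∣n) , cube {r} pr sq with prime∣^*^ a b pp pq pr (∣-trans (m∣m*n (r ^ 2)) d∣n)
      ...   | inj₁ refl = contradiction (∣-trans (∣-trans q∣q^b (n∣m*n (p ^ a))) (subst (p ^ a * q ^ b ∣_) (sym (^-distribˡ-+-* p 3 3)) sq)) (q∤p^ 6)
      ...   | inj₂ refl = contradiction (∣-trans (∣-trans p∣p^a (m∣m*n (q ^ b))) (subst (p ^ a * q ^ b ∣_) (sym (^-distribˡ-+-* q 3 3)) sq)) (p∤q^ 6)
      to v | (_ , d<n , d∣n) , semiprime {r} {s} pr ps r≢s sq
        with prime∣^*^ a b pp pq pr (∣-trans (m∣m*n s) d∣n) | prime∣^*^ a b pp pq ps (∣-trans (n∣m*n r) d∣n)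
      ...   | inj₁ refl | inj₁ refl = contradiction refl r≢s
      ...   | inj₁ refl | inj₂ refl = inj₂ (inj₂ (refl , semiprime-bounds sq d<n))
      ...   | inj₂ refl | inj₁ refl = inj₂ (inj₂ (*-comm q p , semiprime-bounds
              (subst (λ x → p ^ a * q ^ b ∣ x * x) (*-comm q p) sq) (subst (_< p ^ a * q ^ b) (*-comm q p) d<n)))
      ...   | inj₂ refl | inj₂ refl = contradiction refl r≢s
      from : d ≡ p ^ 2 × 2 ≤ a ⊎ d ≡ q ^ 2 × 2 ≤ b ⊎ d ≡ p * q × a ≤ 2 × b ≤ 2 × (2 ≤ a ⊎ 2 ≤ b) →
             V₂ (p ^ a * q ^ b) d
      from (inj₁ (refl , 2≤a)) = square∈V₂ pp pq (p≢q ∘ sym) (∣-trans (^-monoʳ-∣ p 2≤a) (m∣m*n (q ^ b))) (∣-trans q∣q^b (n∣m*n (p ^ a)))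
      from (inj₂ (inj₁ (refl , 2≤b))) = square∈V₂ pq pp p≢q (∣-trans (^-monoʳ-∣ q 2≤b) (n∣m*n (p ^ a))) (∣-trans p∣p^a (m∣m*n (q ^ b)))
      from (inj₂ (inj₂ (refl , a≤2 , b≤2 , wide))) = Equivalence.from V₂⇔
        ( (<-≤-trans 1<p (m≤m*n p q) , semiprime<n wide , *-pres-∣ p∣p^a q∣q^b)
        , semiprime pp pq p≢q (subst (p ^ a * q ^ b ∣_) (sym ([pq]²≡p²q² p q)) (*-pres-∣ (^-monoʳ-∣ p a≤2) (^-monoʳ-∣ q b≤2))))

  V₂-pq : ∀ d → ¬ V₂ (p * q) d
  V₂-pq d v with Equivalence.to (V₂-p^a*q^b ≤-refl ≤-refl d)
                          (subst (λ n → V₂ n d) (sym (cong₂ _*_ (*-identityʳ p) (*-identityʳ q))) v)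
  ... | inj₁ (_ , s≤s ())
  ... | inj₂ (inj₁ (_ , s≤s ()))
  ... | inj₂ (inj₂ (_ , _ , _ , inj₁ (s≤s ())))
  ... | inj₂ (inj₂ (_ , _ , _ , inj₂ (s≤s ())))

  V₂-p²q : ∀ d → V₂ (p ^ 2 * q) d ⇔ (d ≡ p ^ 2 ⊎ d ≡ p * q)
  V₂-p²q d = mk⇔ (to ∘ Equivalence.to (V₂-p^a*q^b (s≤s z≤n) ≤-refl d) ∘ subst (λ n → V₂ n d) p²q≡p²q¹)
                 (subst (λ n → V₂ n d) (sym p²q≡p²q¹) ∘ Equivalence.from (V₂-p^a*q^b (s≤s z≤n) ≤-refl d) ∘ from)
    where
    p²q≡p²q¹ : p ^ 2 * q ≡ p ^ 2 * q ^ 1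
    p²q≡p²q¹ = cong (p ^ 2 *_) (sym (*-identityʳ q))
    to : d ≡ p ^ 2 × 2 ≤ 2 ⊎ d ≡ q ^ 2 × 2 ≤ 1 ⊎ d ≡ p * q × 2 ≤ 2 × 1 ≤ 2 × (2 ≤ 2 ⊎ 2 ≤ 1) →
         d ≡ p ^ 2 ⊎ d ≡ p * q
    to (inj₁ (d≡p² , _)) = inj₁ d≡p²
    to (inj₂ (inj₁ (_ , s≤s ())))
    to (inj₂ (inj₂ (d≡pq , _))) = inj₂ d≡pq
    from : d ≡ p ^ 2 ⊎ d ≡ p * q →
           d ≡ p ^ 2 × 2 ≤ 2 ⊎ d ≡ q ^ 2 × 2 ≤ 1 ⊎ d ≡ p * q × 2 ≤ 2 × 1 ≤ 2 × (2 ≤ 2 ⊎ 2 ≤ 1)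
    from (inj₁ d≡p²) = inj₁ (d≡p² , ≤-refl)
    from (inj₂ d≡pq) = inj₂ (inj₂ (d≡pq , ≤-refl , s≤s z≤n , inj₁ ≤-refl))

  V₂-p²q² : ∀ d → V₂ (p ^ 2 * q ^ 2) d ⇔ (d ≡ p ^ 2 ⊎ d ≡ q ^ 2 ⊎ d ≡ p * q)
  V₂-p²q² d = mk⇔ (to ∘ Equivalence.to (V₂-p^a*q^b (s≤s z≤n) (s≤s z≤n) d))
                  (Equivalence.from (V₂-p^a*q^b (s≤s z≤n) (s≤s z≤n) d) ∘ from)
    where
    to : d ≡ p ^ 2 × 2 ≤ 2 ⊎ d ≡ q ^ 2 × 2 ≤ 2 ⊎ d ≡ p * q × 2 ≤ 2 × 2 ≤ 2 × (2 ≤ 2 ⊎ 2 ≤ 2) →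
         d ≡ p ^ 2 ⊎ d ≡ q ^ 2 ⊎ d ≡ p * q
    to (inj₁ (d≡p² , _)) = inj₁ d≡p²
    to (inj₂ (inj₁ (d≡q² , _))) = inj₂ (inj₁ d≡q²)
    to (inj₂ (inj₂ (d≡pq , _))) = inj₂ (inj₂ d≡pq)
    from : d ≡ p ^ 2 ⊎ d ≡ q ^ 2 ⊎ d ≡ p * q →
           d ≡ p ^ 2 × 2 ≤ 2 ⊎ d ≡ q ^ 2 × 2 ≤ 2 ⊎ d ≡ p * q × 2 ≤ 2 × 2 ≤ 2 × (2 ≤ 2 ⊎ 2 ≤ 2)
    from (inj₁ d≡p²) = inj₁ (d≡p² , ≤-refl)
    from (inj₂ (inj₁ d≡q²)) = inj₂ (inj₁ (d≡q² , ≤-refl))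
    from (inj₂ (inj₂ d≡pq)) = inj₂ (inj₂ (d≡pq , ≤-refl , ≤-refl , inj₁ ≤-refl))

prime^-exceptional : ∀ {p j} → Prime p → 2 < j → j ≤ 6 → Exceptional (p ^ j)
prime^-exceptional {p} {3} pp _ _ = inj₁ (p , pp , inj₁ refl)
prime^-exceptional {p} {4} pp _ _ = inj₁ (p , pp , inj₂ (inj₁ refl))
prime^-exceptional {p} {5} pp _ _ = inj₁ (p , pp , inj₂ (inj₂ (inj₁ refl)))
prime^-exceptional {p} {6} pp _ _ = inj₁ (p , pp , inj₂ (inj₂ (inj₂ refl)))
prime^-exceptional {j = 0} _ () _
prime^-exceptional {j = 1} _ (s≤s ()) _
prime^-exceptional {j = 2} _ (s≤s (s≤s ())) _
prime^-exceptional {j = suc (suc (suc (suc (suc (suc (suc _))))))} _ _ (s≤s (s≤s (s≤s (s≤s (s≤s (s≤s ()))))))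

V₂-nonexceptional : ∀ n → Composite n → ¬ (∃[ p ] (Prime p × n ≡ p ^ 2)) → ¬ Exceptional n →
                    ∀ d → V₂ n d ⇔ (∃[ p ] (Prime p × p ^ 2 ∣ n × d ≡ p ^ 2))
V₂-nonexceptional n cn ¬square ¬exceptional d = mk⇔ to from
  where
  instance
    n≢0 = composite⇒nonZero cn
  to : V₂ n d → ∃[ p ] (Prime p × p ^ 2 ∣ n × d ≡ p ^ 2)
  to v with Equivalence.to V₂⇔ v
  ... | (_ , _ , d∣n) , square pp _ = _ , pp , d∣n , refl
  ... | (_ , d<n , _) , cube {p} pp sq with ∣-prime^ pp 6 (subst (n ∣_) (sym (^-distribˡ-+-* p 3 3)) sq)
  ...   | j , j≤6 , refl = contradiction (prime^-exceptional pp (<-trans (n<1+n 2) (^-cancelʳ-< (prime>1 pp) d<n)) j≤6) ¬exceptional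
  to v | (_ , d<n , divides m refl) , semiprime {p} {q} pp pq p≢q sq
    with ∣-*-primes {w = m} pp pq (*-cancelʳ-∣ (p * q) {{m*n≢0 p q {{prime⇒nonZero pp}} {{prime⇒nonZero pq}}}} sq)
  ... | inj₁ refl = contradiction d<n (<-irrefl (sym (*-identityˡ (p * q))))
  ... | inj₂ (inj₁ refl) = contradiction (inj₂ (p , q , pp , pq , p≢q , inj₂ (inj₁ (p*[p*q]≡p²q p q)))) ¬exceptional
  ... | inj₂ (inj₂ (inj₁ refl)) = contradiction (inj₂ (q , p , pq , pp , p≢q ∘ sym , inj₂ (inj₁ (trans (cong (q *_) (*-comm p q)) (p*[p*q]≡p²q q p))))) ¬exceptional
  ... | inj₂ (inj₂ (inj₂ refl)) = contradiction (inj₂ (p , q , pp , pq , p≢q , inj₂ (inj₂ ([pq]²≡p²q² p q)))) ¬exceptional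
  from : ∃[ p ] (Prime p × p ^ 2 ∣ n × d ≡ p ^ 2) → V₂ n d
  from (p , pp , p²∣n , refl) = Equivalence.from V₂⇔
    ( (^-monoʳ-< p 1<p {0} {2} z<s , ≤∧≢⇒< (∣⇒≤ p²∣n) (λ p²≡n → ¬square (p , pp , sym p²≡n)) , p²∣n)
    , square pp (n∤p⁴ ∘ subst (n ∣_) (sym (^-distribˡ-+-* p 2 2))))
    where
    1<p = prime>1 pp
    n∤p⁴ : ¬ n ∣ p ^ 4
    n∤p⁴ n∣p⁴ with ∣-prime^ pp 4 n∣p⁴
    ... | j , j≤4 , refl = ¬exceptional (prime^-exceptional pp
      (≤∧≢⇒< (^-cancelʳ-∣ 1<p p²∣n) (λ 2≡j → ¬square (p , pp , cong (p ^_) (sym 2≡j)))) (≤-trans j≤4 (m≤m+n 4 2)))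

proposition2p6 :
  -- (i)
  (∀ p → Prime p → ∀ d → ¬ V₂ (p ^ 3) d)
  × (∀ p → Prime p → ∀ d → V₂ (p ^ 4) d ⇔ d ≡ p ^ 3)
  × (∀ p → Prime p → ∀ n → (n ≡ p ^ 5 ⊎ n ≡ p ^ 6) →
       ∀ d → V₂ n d ⇔ (d ≡ p ^ 2 ⊎ d ≡ p ^ 3))
  -- (ii)
  × (∀ p q → Prime p → Prime q → p ≢ q → ∀ d → ¬ V₂ (p * q) d)
  × (∀ p q → Prime p → Prime q → p ≢ q →
       ∀ d → V₂ (p ^ 2 * q) d ⇔ (d ≡ p ^ 2 ⊎ d ≡ p * q))
  × (∀ p q → Prime p → Prime q → p ≢ q →
       ∀ d → V₂ (p ^ 2 * q ^ 2) d ⇔ (d ≡ p ^ 2 ⊎ d ≡ q ^ 2 ⊎ d ≡ p * q))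
  -- (iii)
  × (∀ n → Composite n → ¬ (∃[ p ] (Prime p × n ≡ p ^ 2)) → ¬ Exceptional n →
       ∀ d → V₂ n d ⇔ (∃[ p ] (Prime p × p ^ 2 ∣ n × d ≡ p ^ 2)))
proposition2p6 =
    (λ _ → V₂-p³)
  , (λ _ → V₂-p⁴)
  , (λ { _ pp _ (inj₁ refl) → V₂-p⁵⋯p⁶ pp ≤-refl (n≤1+n 5)
       ; _ pp _ (inj₂ refl) → V₂-p⁵⋯p⁶ pp (n≤1+n 5) ≤-refl })
  , (λ _ _ → V₂-pq)
  , (λ _ _ → V₂-p²q)
  , (λ _ _ → V₂-p²q²)
  , V₂-nonexceptional
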